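{- Let $P$ be an MAV structure. If for every MAV-frame $F=(F,\le,⅋,\lhd,i,+)$ and every valuation $V$ of the atoms in $\mathrm{Chu}(F)$, the interpretation satisfies $I\sqsubseteq[\![P]\!]$ in $\mathrm{Chu}(F)$, then $P\longrightarrow^*\mathbf 1$ in MAV.
   Context: MAV syntax: structures $P ::= a \mid a^\perp \mid \mathbf{1} \mid P;Q \mid P\otimes Q \mid P⅋Q \mid P\& Q \mid P\oplus Q$ over a set of atoms, with duality $(a)^\perp=a^\perp$, $(a^\perp)^\perp=a$, $\mathbf 1^\perp=\mathbf 1$, $(P\otimes Q)^\perp=P^\perp⅋Q^\perp$, $(P⅋Q)^\perp=P^\perp\otimes Q^\perp$, $(P;Q)^\perp=P^\perp;Q^\perp$, $(P\&Q)^\perp=P^\perp\oplus Q^\perp$, $(P\oplus Q)^\perp=P^\perp\&Q^\perp$; structures taken modulo the congruence making $(;,\mathbf 1)$ a monoid and $(\otimes,\mathbf 1),(⅋,\mathbf 1)$ commutative monoids. $P\longrightarrow Q$ is the least context-closed relation containing: $P⅋P^\perp\to\mathbf 1$; $(P\otimes Q)⅋R\to P\otimes(Q⅋R)$; $\mathbf 1\&\mathbf 1\to\mathbf 1$; $(P;Q)⅋(R;S)\to(P⅋R);(Q⅋S)$; $P\oplus Q\to P$; $P\oplus Q\to Q$; $(P\&Q)⅋R\to(P⅋R)\&(Q⅋R)$; $(P;Q)\&(R;S)\to(P\&R);(Q\&S)$; $\mathbf 1\to P\otimes P^\perp$; $\mathbf 1\to\mathbf 1\oplus\mathbf 1$;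 $(P\otimes R);(Q\otimes S)\to(P;Q)\otimes(R;S)$; $P\to P\&Q$; $Q\to P\&Q$; $(P\otimes R)\oplus(Q\otimes R)\to(P\oplus Q)\otimes R$; $(P\oplus R);(Q\oplus S)\to(P;Q)\oplus(R;S)$. $\longrightarrow^*$ is its reflexive–transitive closure. An MAV-frame is $(F,\le,⅋,\lhd,i,+)$ with $(F,\le)$ a poset, $(⅋,i)$ a commutative monoid with $⅋$ monotone, $(\lhd,i)$ a monoid with $\lhd$ monotone, $+$ a monotone binary operation, such that $(w\lhd x)⅋(y\lhd z)\le(w⅋y)\lhd(x⅋z)$, $(x+y)⅋z\le(x⅋z)+(y⅋z)$, $(w\lhd x)+(y\lhd z)\le(w+y)\lhd(x+z)$, and $i+i\le i$. Construction $\mathrm{Chu}(F)$: a lower set is a down-closed $X\subseteq F$; $\eta(x)=\{y\mid y\le x\}$. For a lower set $X$, $\alpha(X)=\{x\mid x\le s$ for some $s$ that is a finite $+$-combination (any binary tree of $+$) of elements of $X\}$. Let $\mathcal C(F)$ be the lower sets closed under $+$, ordered by $\subseteq$; it has meets $\cap$ and joins $X\vee Y=\alpha(X\cup Y)$. Put $K=\eta(i)$, $X\circledast Y=\alpha(\{z\mid z\le x⅋y, x\in X,y\in Y\})$, $X\,\hat\lhd\, Y=\{z\mid z\le x\lhd y,x\in X,y\in Y\}$, $X\multimap Y=\{z\mid \forall x\in X,\ z⅋x\in Y\}$. $\mathrm{Chu}(F)$ consists of pairs $(X^+,X^-)$ of elements of $\mathcal C(F)$ with $X^+\circledast X^-\subseteq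 K$, ordered by $(X^+,X^-)\sqsubseteq(Y^+,Y^-)$ iff $X^+\subseteq Y^+$ and $Y^-\subseteq X^-$, with $X\otimes Y=(X^+\circledast Y^+,(Y^+\multimap X^-)\cap(X^+\multimap Y^-))$, $I=(K,K)$, $\neg(X^+,X^-)=(X^-,X^+)$, $X\lhd Y=(X^+\hat\lhd Y^+,X^-\hat\lhd Y^-)$, $X\&Y=(X^+\cap Y^+,X^-\vee Y^-)$. Given a valuation $V$ from atoms to $\mathrm{Chu}(F)$, the interpretation is $[\![\mathbf 1]\!]=I$, $[\![a]\!]=V(a)$, $[\![a^\perp]\!]=\neg V(a)$, $[\![P\otimes Q]\!]=[\![P]\!]\otimes[\![Q]\!]$, $[\![P⅋Q]\!]=\neg(\neg[\![P]\!]\otimes\neg[\![Q]\!])$, $[\![P;Q]\!]=[\![P]\!]\lhd[\![Q]\!]$, $[\![P\&Q]\!]=[\![P]\!]\&[\![Q]\!]$, $[\![P\oplus Q]\!]=\neg(\neg[\![P]\!]\&\neg[\![Q]\!])$. -}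

module Defs where

open import Level using (0ℓ)
open import Data.Product using (Σ; ∃; _×_; _,_)
open import Data.Sum using (_⊎_)
open import Relation.Unary using (Pred; _⊆_; _∩_; _∪_)
open import Relation.Binary.Structures using (IsPartialOrder)

infixr 7 _⊗_ _⅋_ _&_ _⊕_
infixr 8 _⨾_

data Str (A : Set) : Set where
  atom  : A → Str A
  natom : A → Str A
  one   : Str A
  _⨾_   : Str A → Str A → Str A
  _⊗_   : Str A → Str A → Str A
  _⅋_   : Str A → Str A → Str A
  _&_   : Str A → Str A → Str A
  _⊕_   : Str A → Str A → Str A

module _ {A : Set} where

  _ᗮ : Str A → Str A
  atom a ᗮ  = natom a
  natom a ᗮ = atom a
  one ᗮ     = one
  (P ⊗ Q) ᗮ = (P ᗮ) ⅋ (Q ᗮ)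
  (P ⅋ Q) ᗮ = (P ᗮ) ⊗ (Q ᗮ)
  (P ⨾ Q) ᗮ = (P ᗮ) ⨾ (Q ᗮ)
  (P & Q) ᗮ = (P ᗮ) ⊕ (Q ᗮ)
  (P ⊕ Q) ᗮ = (P ᗮ) & (Q ᗮ)

  infix 4 _≅_
  data _≅_ : Str A → Str A → Set where
    ≅-refl  : ∀ {P} → P ≅ P
    ≅-sym   : ∀ {P Q} → P ≅ Q → Q ≅ P
    ≅-trans : ∀ {P Q R} → P ≅ Q → Q ≅ R → P ≅ R
    ⨾-assoc : ∀ {P Q R} → (P ⨾ Q) ⨾ R ≅ P ⨾ (Q ⨾ R)
    ⨾-unitˡ : ∀ {P} → one ⨾ P ≅ P
    ⨾-unitʳ : ∀ {P} → P ⨾ one ≅ P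
    ⊗-assoc : ∀ {P Q R} → (P ⊗ Q) ⊗ R ≅ P ⊗ (Q ⊗ R)
    ⊗-comm  : ∀ {P Q} → P ⊗ Q ≅ Q ⊗ P
    ⊗-unit  : ∀ {P} → one ⊗ P ≅ P
    ⅋-assoc : ∀ {P Q R} → (P ⅋ Q) ⅋ R ≅ P ⅋ (Q ⅋ R)
    ⅋-comm  : ∀ {P Q} → P ⅋ Q ≅ Q ⅋ P
    ⅋-unit  : ∀ {P} → one ⅋ P ≅ P
    ⨾-cong  : ∀ {P P' Q Q'} → P ≅ P' → Q ≅ Q' → P ⨾ Q ≅ P' ⨾ Q'
    ⊗-cong  : ∀ {P P' Q Q'} → P ≅ P' → Q ≅ Q' → P ⊗ Q ≅ P' ⊗ Q'
    ⅋-cong  : ∀ {P P' Q Q'} → P ≅ P' → Q ≅ Q' → P ⅋ Q ≅ P' ⅋ Q'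
    &-cong  : ∀ {P P' Q Q'} → P ≅ P' → Q ≅ Q' → P & Q ≅ P' & Q'
    ⊕-cong  : ∀ {P P' Q Q'} → P ≅ P' → Q ≅ Q' → P ⊕ Q ≅ P' ⊕ Q'

  infix 4 _⟶_
  data _⟶_ : Str A → Str A → Set where
    interact : ∀ {P} → P ⅋ (P ᗮ) ⟶ one
    switch     : ∀ {P Q R} → (P ⊗ Q) ⅋ R ⟶ P ⊗ (Q ⅋ R)
    tidy       : one & one ⟶ one
    sequence   : ∀ {P Q R S} → (P ⨾ Q) ⅋ (R ⨾ S) ⟶ (P ⅋ R) ⨾ (Q ⅋ S)
    left       : ∀ {P Q} → P ⊕ Q ⟶ P
    right      : ∀ {P Q} → P ⊕ Q ⟶ Q
    external   : ∀ {P Q R} → (P & Q) ⅋ R ⟶ (P ⅋ R) & (Q ⅋ R)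
    medial     : ∀ {P Q R S} → (P ⨾ Q) & (R ⨾ S) ⟶ (P & R) ⨾ (Q & S)
    co-interact : ∀ {P} → one ⟶ P ⊗ (P ᗮ)
    co-tidy    : one ⟶ one ⊕ one
    co-sequence : ∀ {P Q R S} → (P ⊗ R) ⨾ (Q ⊗ S) ⟶ (P ⨾ Q) ⊗ (R ⨾ S)
    co-left    : ∀ {P Q} → P ⟶ P & Q
    co-right   : ∀ {P Q} → Q ⟶ P & Q
    co-external : ∀ {P Q R} → (P ⊗ R) ⊕ (Q ⊗ R) ⟶ (P ⊕ Q) ⊗ R
    co-medial  : ∀ {P Q R S} → (P ⊕ R) ⨾ (Q ⊕ S) ⟶ (P ⨾ Q) ⊕ (R ⨾ S)
    ⨾ˡ : ∀ {P P' Q} → P ⟶ P' → P ⨾ Q ⟶ P' ⨾ Q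
    ⨾ʳ : ∀ {P Q Q'} → Q ⟶ Q' → P ⨾ Q ⟶ P ⨾ Q'
    ⊗ˡ : ∀ {P P' Q} → P ⟶ P' → P ⊗ Q ⟶ P' ⊗ Q
    ⊗ʳ : ∀ {P Q Q'} → Q ⟶ Q' → P ⊗ Q ⟶ P ⊗ Q'
    ⅋ˡ : ∀ {P P' Q} → P ⟶ P' → P ⅋ Q ⟶ P' ⅋ Q
    ⅋ʳ : ∀ {P Q Q'} → Q ⟶ Q' → P ⅋ Q ⟶ P ⅋ Q'
    &ˡ : ∀ {P P' Q} → P ⟶ P' → P & Q ⟶ P' & Q
    &ʳ : ∀ {P Q Q'} → Q ⟶ Q' → P & Q ⟶ P & Q'
    ⊕ˡ : ∀ {P P' Q} → P ⟶ P' → P ⊕ Q ⟶ P' ⊕ Q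
    ⊕ʳ : ∀ {P Q Q'} → Q ⟶ Q' → P ⊕ Q ⟶ P ⊕ Q'
    mod≅ : ∀ {P P' Q Q'} → P ≅ P' → P' ⟶ Q' → Q' ≅ Q → P ⟶ Q

  infix 4 _⟶*_
  data _⟶*_ : Str A → Str A → Set where
    done : ∀ {P Q} → P ≅ Q → P ⟶* Q
    step : ∀ {P Q R} → P ⟶ Q → Q ⟶* R → P ⟶* R

record MAVFrame : Set₁ where
  infixr 7 _⅋ᶠ_ _◁_ _+_
  field
    Carrier : Set
    _≈_     : Carrier → Carrier → Set
    _≤_     : Carrier → Carrier → Set
    isPartialOrder : IsPartialOrder _≈_ _≤_
    _⅋ᶠ_ _◁_ _+_ : Carrier → Carrier → Carrier
    i       : Carrier
    ⅋ᶠ-assoc : ∀ x y z → ((x ⅋ᶠ y) ⅋ᶠ z) ≈ (x ⅋ᶠ (y ⅋ᶠ z))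
    ⅋ᶠ-comm  : ∀ x y → (x ⅋ᶠ y) ≈ (y ⅋ᶠ x)
    ⅋ᶠ-identityˡ : ∀ x → (i ⅋ᶠ x) ≈ x
    ⅋ᶠ-mono  : ∀ {x x' y y'} → x ≤ x' → y ≤ y' → (x ⅋ᶠ y) ≤ (x' ⅋ᶠ y')
    ◁-assoc : ∀ x y z → ((x ◁ y) ◁ z) ≈ (x ◁ (y ◁ z))
    ◁-identityˡ : ∀ x → (i ◁ x) ≈ x
    ◁-identityʳ : ∀ x → (x ◁ i) ≈ x
    ◁-mono  : ∀ {x x' y y'} → x ≤ x' → y ≤ y' → (x ◁ y) ≤ (x' ◁ y')
    +-mono  : ∀ {x x' y y'} → x ≤ x' → y ≤ y' → (x + y) ≤ (x' + y')
    ⅋ᶠ-◁     : ∀ w x y z → ((w ◁ x) ⅋ᶠ (y ◁ z)) ≤ ((w ⅋ᶠ y) ◁ (x ⅋ᶠ z))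
    +-⅋ᶠ     : ∀ x y z → ((x + y) ⅋ᶠ z) ≤ ((x ⅋ᶠ z) + (y ⅋ᶠ z))
    ◁-+     : ∀ w x y z → ((w ◁ x) + (y ◁ z)) ≤ ((w + y) ◁ (x + z))
    i+i     : (i + i) ≤ i

module ChuOf (F : MAVFrame) where
  open MAVFrame F

  Subset : Set₁
  Subset = Pred Carrier 0ℓ

  LowerSet : Subset → Set
  LowerSet X = ∀ {x y} → y ≤ x → X x → X y

  η : Carrier → Subset
  η x y = y ≤ x

  data PlusComb (X : Subset) : Carrier → Set where
    leaf : ∀ {x} → X x → PlusComb X x
    node : ∀ {s t} → PlusComb X s → PlusComb X t → PlusComb X (s + t)

  α : Subset → Subset
  α X x = ∃ λ s → PlusComb X s × x ≤ s

  PlusClosed : Subset → Set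
  PlusClosed X = ∀ {x y} → X x → X y → X (x + y)

  InC : Subset → Set
  InC X = LowerSet X × PlusClosed X

  _∨C_ : Subset → Subset → Subset
  X ∨C Y = α (X ∪ Y)

  K : Subset
  K = η i

  _⊛_ : Subset → Subset → Subset
  X ⊛ Y = α (λ z → ∃ λ x → ∃ λ y → X x × Y y × z ≤ (x ⅋ᶠ y))

  _◁̂_ : Subset → Subset → Subset
  (X ◁̂ Y) z = ∃ λ x → ∃ λ y → X x × Y y × z ≤ (x ◁ y)

  _⊸_ : Subset → Subset → Subset
  (X ⊸ Y) z = ∀ x → X x → Y (z ⅋ᶠ x)

  -- pairs (X⁺ , X⁻); the Chu operations act on the raw pairs
  record Pair : Set₁ where
    constructor ⟨_,_⟩
    field
      pos : Subset
      neg : Subset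
  open Pair public

  IsChu : Pair → Set
  IsChu X = InC (pos X) × InC (neg X) × ((pos X ⊛ neg X) ⊆ K)

  record Chu : Set₁ where
    field
      pair  : Pair
      isChu : IsChu pair
  open Chu public

  _⊑_ : Pair → Pair → Set
  X ⊑ Y = (pos X ⊆ pos Y) × (neg Y ⊆ neg X)

  _⊗ᶜ_ : Pair → Pair → Pair
  X ⊗ᶜ Y = ⟨ pos X ⊛ pos Y , (pos Y ⊸ neg X) ∩ (pos X ⊸ neg Y) ⟩

  Iᶜ : Pair
  Iᶜ = ⟨ K , K ⟩

  ¬ᶜ : Pair → Pair
  ¬ᶜ X = ⟨ neg X , pos X ⟩

  _◁ᶜ_ : Pair → Pair → Pair
  X ◁ᶜ Y = ⟨ pos X ◁̂ pos Y , neg X ◁̂ neg Y ⟩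

  _&ᶜ_ : Pair → Pair → Pair
  X &ᶜ Y = ⟨ pos X ∩ pos Y , neg X ∨C neg Y ⟩

  ⟦_⟧ : {A : Set} → Str A → (A → Chu) → Pair
  ⟦ one ⟧     V = Iᶜ
  ⟦ atom a ⟧  V = pair (V a)
  ⟦ natom a ⟧ V = ¬ᶜ (pair (V a))
  ⟦ P ⊗ Q ⟧   V = ⟦ P ⟧ V ⊗ᶜ ⟦ Q ⟧ V
  ⟦ P ⅋ Q ⟧   V = ¬ᶜ (¬ᶜ (⟦ P ⟧ V) ⊗ᶜ ¬ᶜ (⟦ Q ⟧ V))
  ⟦ P ⨾ Q ⟧   V = ⟦ P ⟧ V ◁ᶜ ⟦ Q ⟧ V
  ⟦ P & Q ⟧   V = ⟦ P ⟧ V &ᶜ ⟦ Q ⟧ V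
  ⟦ P ⊕ Q ⟧   V = ¬ᶜ (¬ᶜ (⟦ P ⟧ V) &ᶜ ¬ᶜ (⟦ Q ⟧ V))

{-# OPTIONS --safe #-}
-- The structures of MAV themselves form an MAV-frame: order them by
-- reachability x ⟶* y and take ⅋, ⨾, & and 1 as ⅋, ◁, + and i; the four
-- frame axioms are then the rules sequence, external, medial and tidy.
-- Interpret an atom a as the Chu pair (α ↓a^⊥ , α ↓a).  By induction on P,
-- every y ⟶* P lies in the negative part of ⟦P⟧, and every x in the positive
-- part of ⟦P⟧ refutes P, i.e. x ⅋ P ⟶* 1.  Since I ⊑ ⟦P⟧ puts the negative
-- part of ⟦P⟧ inside K = ↓1, and P itself lies in it, P ⟶* 1.
module Submission where

open import Defs
open import Data.Product using (_×_; _,_; proj₁; proj₂)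
open import Data.Sum using (inj₁; inj₂)
open import Relation.Unary using (_⊆_)
open import Relation.Binary.Structures using (IsPartialOrder)

module Closure (F : MAVFrame) where
  open MAVFrame F
  open ChuOf F
  open IsPartialOrder isPartialOrder using (trans)

  α-InC : (X : Subset) → InC (α X)
  α-InC X = (λ { y≤x (s , c , x≤s) → s , c , trans y≤x x≤s })
          , (λ { (s , c , x≤s) (t , d , y≤t) → s + t , node c d , +-mono x≤s y≤t })

  α-least : {X Y : Subset} → InC Y → X ⊆ Y → α X ⊆ Y
  α-least {X} {Y} (lower , plus) X⊆Y (s , c , x≤s) = lower x≤s (combination c)
    where
    combination : ∀ {s} → PlusComb X s → Y s
    combination (leaf x)   = X⊆Y x
    combination (node c d) = plus (combination c) (combination d)

  K-InC : InC K
  K-InC = trans , λ x≤i y≤i → trans (+-mono x≤i y≤i) i+i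

module _ {A : Set} where

  infixr 5 _◅◅_
  _◅◅_ : {P Q R : Str A} → P ⟶* Q → Q ⟶* R → P ⟶* R
  done e   ◅◅ done e′  = done (≅-trans e e′)
  done e   ◅◅ step s r = step (mod≅ e s ≅-refl) r
  step s r ◅◅ r′       = step s (r ◅◅ r′)

  ⟶*-refl : {P : Str A} → P ⟶* P
  ⟶*-refl = done ≅-refl

  ⟶⇒⟶* : {P Q : Str A} → P ⟶ Q → P ⟶* Q
  ⟶⇒⟶* s = step s ⟶*-refl

  lift* : (C : Str A → Str A) →
          (∀ {P Q} → P ≅ Q → C P ≅ C Q) → (∀ {P Q} → P ⟶ Q → C P ⟶ C Q) →
          ∀ {P Q} → P ⟶* Q → C P ⟶* C Q
  lift* C cong⁼ cong⟶ (done e)   = done (cong⁼ e)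
  lift* C cong⁼ cong⟶ (step s r) = step (cong⟶ s) (lift* C cong⁼ cong⟶ r)

  ⅋ˡ* : {P P′ Q : Str A} → P ⟶* P′ → P ⅋ Q ⟶* P′ ⅋ Q
  ⅋ˡ* = lift* _ (λ e → ⅋-cong e ≅-refl) ⅋ˡ

  ⅋ʳ* : {P Q Q′ : Str A} → Q ⟶* Q′ → P ⅋ Q ⟶* P ⅋ Q′
  ⅋ʳ* = lift* _ (⅋-cong ≅-refl) ⅋ʳ

  ⊗ʳ* : {P Q Q′ : Str A} → Q ⟶* Q′ → P ⊗ Q ⟶* P ⊗ Q′
  ⊗ʳ* = lift* _ (⊗-cong ≅-refl) ⊗ʳ

  ⨾ˡ* : {P P′ Q : Str A} → P ⟶* P′ → P ⨾ Q ⟶* P′ ⨾ Q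
  ⨾ˡ* = lift* _ (λ e → ⨾-cong e ≅-refl) ⨾ˡ

  ⨾ʳ* : {P Q Q′ : Str A} → Q ⟶* Q′ → P ⨾ Q ⟶* P ⨾ Q′
  ⨾ʳ* = lift* _ (⨾-cong ≅-refl) ⨾ʳ

  &ˡ* : {P P′ Q : Str A} → P ⟶* P′ → P & Q ⟶* P′ & Q
  &ˡ* = lift* _ (λ e → &-cong e ≅-refl) &ˡ

  &ʳ* : {P Q Q′ : Str A} → Q ⟶* Q′ → P & Q ⟶* P & Q′
  &ʳ* = lift* _ (&-cong ≅-refl) &ʳ

  syntacticFrame : MAVFrame
  syntacticFrame = record
    { Carrier        = Str A
    ; _≈_            = λ P Q → (P ⟶* Q) × (Q ⟶* P)
    ; _≤_            = _⟶*_
    ; isPartialOrder = record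
      { isPreorder = record
        { isEquivalence = record
          { refl  = ⟶*-refl , ⟶*-refl
          ; sym   = λ { (p , q) → q , p }
          ; trans = λ { (p , q) (p′ , q′) → p ◅◅ p′ , q′ ◅◅ q } }
        ; reflexive = proj₁
        ; trans     = _◅◅_ }
      ; antisym = _,_ }
    ; _⅋ᶠ_         = _⅋_
    ; _◁_          = _⨾_
    ; _+_          = _&_
    ; i            = one
    ; ⅋ᶠ-assoc     = λ _ _ _ → ≅⇒≈ ⅋-assoc
    ; ⅋ᶠ-comm      = λ _ _ → ≅⇒≈ ⅋-comm
    ; ⅋ᶠ-identityˡ = λ _ → ≅⇒≈ ⅋-unit
    ; ⅋ᶠ-mono      = λ p q → ⅋ˡ* p ◅◅ ⅋ʳ* q
    ; ◁-assoc      = λ _ _ _ → ≅⇒≈ ⨾-assoc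
    ; ◁-identityˡ  = λ _ → ≅⇒≈ ⨾-unitˡ
    ; ◁-identityʳ  = λ _ → ≅⇒≈ ⨾-unitʳ
    ; ◁-mono       = λ p q → ⨾ˡ* p ◅◅ ⨾ʳ* q
    ; +-mono       = λ p q → &ˡ* p ◅◅ &ʳ* q
    ; ⅋ᶠ-◁         = λ _ _ _ _ → ⟶⇒⟶* sequence
    ; +-⅋ᶠ         = λ _ _ _ → ⟶⇒⟶* external
    ; ◁-+          = λ _ _ _ _ → ⟶⇒⟶* medial
    ; i+i          = ⟶⇒⟶* tidy
    }
    where
    ≅⇒≈ : {P Q : Str A} → P ≅ Q → (P ⟶* Q) × (Q ⟶* P)
    ≅⇒≈ e = done e , done (≅-sym e)

module CanonicalModel {A : Set} where
  open ChuOf (syntacticFrame {A})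
  open Closure (syntacticFrame {A})

  Refutes : Str A → Subset
  Refutes R x = x ⅋ R ⟶* one

  refutes-sym : {R x : Str A} → Refutes R x → Refutes x R
  refutes-sym r = done ⅋-comm ◅◅ r

  refutes-lower : (R : Str A) → LowerSet (Refutes R)
  refutes-lower R y⟶x r = ⅋ˡ* y⟶x ◅◅ r

  refutes-& : (R : Str A) → PlusClosed (Refutes R)
  refutes-& R r s = ⟶⇒⟶* external ◅◅ &ˡ* r ◅◅ &ʳ* s ◅◅ ⟶⇒⟶* tidy

  refutes-InC : (R : Str A) → InC (Refutes R)
  refutes-InC R = refutes-lower R , refutes-& R

  refutes-antitone : {R R′ x : Str A} → R ⟶* R′ → Refutes R′ x → Refutes R x
  refutes-antitone R⟶R′ r = ⅋ʳ* R⟶R′ ◅◅ r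

  αη⊆Refutesᗮ : (P : Str A) → α (η P) ⊆ Refutes (P ᗮ)
  αη⊆Refutesᗮ P = α-least (refutes-InC (P ᗮ)) (λ y⟶P → ⅋ˡ* y⟶P ◅◅ ⟶⇒⟶* interact)

  αηᗮ⊆Refutes : (P : Str A) → α (η (P ᗮ)) ⊆ Refutes P
  αηᗮ⊆Refutes P = α-least (refutes-InC P) λ y⟶Pᗮ →
    refutes-lower P y⟶Pᗮ (refutes-sym (αη⊆Refutesᗮ P (P , leaf ⟶*-refl , ⟶*-refl)))

  canonical : Str A → Chu
  canonical P = record
    { pair  = ⟨ α (η (P ᗮ)) , α (η P) ⟩
    ; isChu = α-InC _ , α-InC _ , α-least K-InC λ { (x , y , x∈ , y∈ , z⟶x⅋y) →
        z⟶x⅋y ◅◅ α-least (refutes-InC y) (λ x′⟶Pᗮ →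
          refutes-lower y x′⟶Pᗮ (refutes-sym (αη⊆Refutesᗮ P y∈))) x∈ } }

  V : A → Chu
  V a = canonical (atom a)

  ⊗-absorb : {P Q x : Str A} → Refutes Q x → (P ⊗ Q) ⅋ x ⟶* P
  ⊗-absorb r = ⟶⇒⟶* switch ◅◅ ⊗ʳ* (refutes-sym r) ◅◅ done (≅-trans ⊗-comm ⊗-unit)

  mutual
    η⊆neg : (P : Str A) → η P ⊆ neg (⟦ P ⟧ V)
    η⊆neg (atom a)  y⟶P = atom a , leaf ⟶*-refl , y⟶P
    η⊆neg (natom a) y⟶P = natom a , leaf ⟶*-refl , y⟶P
    η⊆neg one       y⟶P = y⟶P
    η⊆neg (P ⨾ Q)   y⟶P = P , Q , η⊆neg P ⟶*-refl , η⊆neg Q ⟶*-refl , y⟶P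
    η⊆neg (P ⊗ Q)   y⟶P =
        (λ x x∈ → η⊆neg P (⅋ˡ* y⟶P ◅◅ ⊗-absorb (pos⊆Refutes Q x∈)))
      , (λ x x∈ → η⊆neg Q (⅋ˡ* y⟶P ◅◅ done (⅋-cong ⊗-comm ≅-refl)
                               ◅◅ ⊗-absorb (pos⊆Refutes P x∈)))
    η⊆neg (P ⅋ Q)   y⟶P =
      P ⅋ Q , leaf (P , Q , η⊆neg P ⟶*-refl , η⊆neg Q ⟶*-refl , ⟶*-refl) , y⟶P
    η⊆neg (P & Q)   y⟶P =
      P & Q , node (leaf (inj₁ (η⊆neg P ⟶*-refl))) (leaf (inj₂ (η⊆neg Q ⟶*-refl))) , y⟶P
    η⊆neg (P ⊕ Q)   y⟶P = η⊆neg P (y⟶P ◅◅ ⟶⇒⟶* left) , η⊆neg Q (y⟶P ◅◅ ⟶⇒⟶* right)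

    pos⊆Refutes : (P : Str A) → pos (⟦ P ⟧ V) ⊆ Refutes P
    pos⊆Refutes (atom a)  = αηᗮ⊆Refutes (atom a)
    pos⊆Refutes (natom a) = αη⊆Refutesᗮ (atom a)
    pos⊆Refutes one x⟶1 = done (≅-trans ⅋-comm ⅋-unit) ◅◅ x⟶1
    pos⊆Refutes (P ⨾ Q) (u , v , u∈ , v∈ , x⟶u⨾v) =
      ⅋ˡ* x⟶u⨾v ◅◅ ⟶⇒⟶* sequence ◅◅ ⨾ˡ* (pos⊆Refutes P u∈) ◅◅ ⨾ʳ* (pos⊆Refutes Q v∈)
      ◅◅ done ⨾-unitˡ
    pos⊆Refutes (P ⊗ Q) = α-least (refutes-InC (P ⊗ Q)) λ { (u , v , u∈ , v∈ , z⟶u⅋v) →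
      refutes-lower (P ⊗ Q) z⟶u⅋v
        (done (≅-trans ⅋-assoc (⅋-cong ≅-refl ⅋-comm))
         ◅◅ ⅋ʳ* (⊗-absorb (pos⊆Refutes Q v∈)) ◅◅ pos⊆Refutes P u∈) }
    pos⊆Refutes (P ⅋ Q) (x⅋Q∈P , _) =
      done (≅-trans (⅋-cong ≅-refl ⅋-comm) (≅-sym ⅋-assoc))
      ◅◅ pos⊆Refutes P (x⅋Q∈P Q (η⊆neg Q ⟶*-refl))
    pos⊆Refutes (P & Q) {x} (x∈P , x∈Q) =
      refutes-sym (refutes-& x (refutes-sym (pos⊆Refutes P x∈P))
                               (refutes-sym (pos⊆Refutes Q x∈Q)))
    pos⊆Refutes (P ⊕ Q) = α-least (refutes-InC (P ⊕ Q)) λ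
      { (inj₁ x∈P) → refutes-antitone (⟶⇒⟶* left) (pos⊆Refutes P x∈P)
      ; (inj₂ x∈Q) → refutes-antitone (⟶⇒⟶* right) (pos⊆Refutes Q x∈Q) }

theorem4p3 : {A : Set} (P : Str A) →
    ((F : MAVFrame) (V : A → ChuOf.Chu F) →
      ChuOf._⊑_ F (ChuOf.Iᶜ F) (ChuOf.⟦_⟧ F P V)) →
    P ⟶* one
theorem4p3 P valid = proj₂ (valid syntacticFrame V) (η⊆neg P ⟶*-refl)
  where open CanonicalModel
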